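{- For every connected hypergraph $\mathcal{H}$ with at least two edges, $\gamma_{P_I}(\mathcal{H})\le\gamma_P(\mathcal{H})\le|E(\mathcal{H})|-1$. Moreover, this bound is tight: there is a connected hypergraph with at least two edges for which $\gamma_{P_I}(\mathcal{H})=\gamma_P(\mathcal{H})=|E(\mathcal{H})|-1$.
   Context: A hypergraph $\mathcal{H}=(V,E)$ has finite vertex set $V$ and edges nonempty subsets of $V$; throughout, hypergraphs are reduced (no edge is contained in another distinct edge). A path is a sequence $v_1,e_1,v_2,\dots,e_\ell,v_{\ell+1}$ of distinct vertices and distinct edges with $v_i,v_{i+1}\in e_i$; $\mathcal{H}$ is connected if any two vertices are joined by a path. $N[a]=\bigcup_{a\in e\in E}e$, $N(a)=N[a]\setminus\{a\}$. Power domination: given $S_0\subseteq V$, first all vertices of $\bigcup_{v\in S_0}N[v]$ become observed; then repeatedly, if all unobserved neighbors of an observed vertex $v$ lie in one edge incident to $v$, they become observed. $\gamma_P(\mathcal{H})$ is the minimum size of an $S_0$ making all vertices observed. Infectious power domination: given $S_0$, set $S=\bigcup_{v\in S_0}N[v]$; then while some nonempty $A\subseteq S$ and edge $e$ satisfy $A\subseteq e$ and [every vertex $v\notin S$ such that $A\cup\{v\}$ is contained in some edge lies in $e$], add the vertices of $e$ to $S$. $\gamma_{P_I}(\mathcal{H})$ is the minimum size of an $S_0$ with $S=V$ at termination. -}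

module Defs where

open import Data.Nat using (ℕ; _≤_)
open import Data.Fin using (Fin)
open import Data.Fin.Subset using (Subset; _∈_; _∉_; _⊆_; _∪_; ⁅_⁆; ⊤; ∣_∣; Nonempty)
open import Data.Product using (Σ; _×_; _,_)
open import Data.Sum using (_⊎_)
open import Relation.Binary.PropositionalEquality using (_≡_; _≢_)
open import Relation.Binary.Construct.Closure.ReflexiveTransitive using (Star)
open import Function.Bundles using (_⇔_)

record Hypergraph : Set where
  field
    n m     : ℕ
    edge    : Fin m → Subset n
    nonempty : ∀ i → Nonempty (edge i)
    reduced : ∀ i j → edge i ⊆ edge j → i ≡ j
open Hypergraph public

V : Hypergraph → Set
V H = Fin (n H)

numEdges : Hypergraph → ℕ
numEdges H = m H

Adj : (H : Hypergraph) → V H → V H → Set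
Adj H u w = Σ (Fin (m H)) λ i → u ∈ edge H i × w ∈ edge H i

Connected : Hypergraph → Set
Connected H = ∀ (u w : V H) → Star (Adj H) u w

InClosedNbhd : (H : Hypergraph) → V H → V H → Set
InClosedNbhd H a w = Adj H a w

InOpenNbhd : (H : Hypergraph) → V H → V H → Set
InOpenNbhd H a w = InClosedNbhd H a w × w ≢ a

Initial : (H : Hypergraph) → Subset (n H) → Subset (n H) → Set
Initial H S0 S = ∀ w → (w ∈ S) ⇔ (Σ (V H) λ v → v ∈ S0 × InClosedNbhd H v w)

PDStep : (H : Hypergraph) → Subset (n H) → Subset (n H) → Set
PDStep H S S' =
  Σ (V H) λ u → u ∈ S ×
  Σ (Fin (m H)) λ i → u ∈ edge H i ×
  (∀ w → InOpenNbhd H u w → w ∉ S → w ∈ edge H i) ×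
  (∀ w → (w ∈ S') ⇔ (w ∈ S ⊎ InOpenNbhd H u w))

PowerDominating : (H : Hypergraph) → Subset (n H) → Set
PowerDominating H S0 =
  Σ (Subset (n H)) λ S → Initial H S0 S ×
  Σ (Subset (n H)) λ T → Star (PDStep H) S T × T ≡ ⊤

PIStep : (H : Hypergraph) → Subset (n H) → Subset (n H) → Set
PIStep H S S' =
  Σ (Subset (n H)) λ A → Nonempty A × A ⊆ S ×
  Σ (Fin (m H)) λ i → A ⊆ edge H i ×
  (∀ v → v ∉ S → (Σ (Fin (m H)) λ j → (A ∪ ⁅ v ⁆) ⊆ edge H j) → v ∈ edge H i) ×
  (∀ w → (w ∈ S') ⇔ (w ∈ S ⊎ w ∈ edge H i))

InfectiousPowerDominating : (H : Hypergraph) → Subset (n H) → Set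
InfectiousPowerDominating H S0 =
  Σ (Subset (n H)) λ S → Initial H S0 S ×
  Σ (Subset (n H)) λ T → Star (PIStep H) S T × T ≡ ⊤

γP≤ : Hypergraph → ℕ → Set
γP≤ H k = Σ (Subset (n H)) λ S0 → ∣ S0 ∣ ≤ k × PowerDominating H S0

γP≡ : Hypergraph → ℕ → Set
γP≡ H k = γP≤ H k × (∀ j → γP≤ H j → k ≤ j)

γPI≤ : Hypergraph → ℕ → Set
γPI≤ H k = Σ (Subset (n H)) λ S0 → ∣ S0 ∣ ≤ k × InfectiousPowerDominating H S0

γPI≡ : Hypergraph → ℕ → Set
γPI≡ H k = γPI≤ H k × (∀ j → γPI≤ H j → k ≤ j)

-- * γ_{P_I} ≤ γ_P: a power-domination step of an observed vertex u along
--   an edge e is an infectious step with A = {u}, so every power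
--   dominating set is infectious power dominating.
-- * γ_P ≤ |E| - 1: fix an edge e₀ and take one vertex from every other
--   edge.  Their closed neighbourhoods cover every edge except e₀.  By
--   connectivity and reducedness some vertex u of e₀ lies in another edge,
--   hence is observed, and every unobserved neighbour of u lies in e₀; one
--   step of u observes all of e₀, and by connectivity every vertex lies in
--   some edge, so everything is observed.
-- * Tightness: a nonempty vertex set needs a nonempty dominating set, so on
--   the path a - b - c with edges {a,b}, {b,c} both parameters equal 1.
module Submission where

open import Defs
open import Data.Nat using (ℕ; _≤_; _<_; _∸_; zero; suc; z≤n; s≤s)
open import Data.Nat.Properties using (≤-refl; ≤-reflexive; ≤-trans; n≤1+n)
open import Data.Product using (Σ; _×_; _,_; proj₁; proj₂)
open import Data.Sum using (_⊎_; inj₁; inj₂)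
open import Data.Bool using (true; false)
open import Data.Empty using (⊥-elim)
open import Data.Fin using (Fin; zero; suc; toℕ; fromℕ<)
open import Data.Fin.Properties using (any?; toℕ-fromℕ<) renaming (_≟_ to _≟F_)
open import Data.Fin.Subset
  using (Subset; _∈_; _∉_; _⊆_; _∪_; ⁅_⁆; ⊤; ⊥; ∁; ∣_∣)
open import Data.Fin.Subset.Properties
  using (_∈?_; ∈⊤; x∈⁅x⁆; x∈⁅y⁆⇒x≡y; x∈p∪q⁺; ∪-identityʳ; ∣⊥∣≡0;
         ∣⁅x⁆∣≡1; ∣∁p∣≡n∸∣p∣; p⊆q⇒∣p∣≤∣q∣; x∉p⇒x∈∁p)
open import Data.Vec using ([]; _∷_; tabulate; here; there)
open import Data.Vec.Properties using (lookup∘tabulate; []=⇒lookup; lookup⇒[]=)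
open import Relation.Unary using (Pred; Decidable)
open import Relation.Nullary using (Dec; yes; no; ¬_; does; proof; ¬?)
open import Relation.Nullary.Reflects using (Reflects; invert)
open import Relation.Nullary.Decidable using (dec-true; _×-dec_)
open import Relation.Binary.PropositionalEquality
  using (_≡_; _≢_; refl; sym; trans; subst; cong)
open import Relation.Binary.Construct.Closure.ReflexiveTransitive
  using (Star; ε; _◅_; _◅◅_) renaming (map to mapStar)
open import Function.Bundles using (_⇔_; mk⇔; Equivalence)
open Equivalence using (to; from)

-- A step of a vertex u along edge i is the infectious step with A = {u}:
-- a vertex v ∉ S sharing an edge with u is an unobserved neighbour of u,
-- so it lies in edge i; conversely every vertex of edge i is u or a
-- neighbour of u.
pdStep⇒piStep : (H : Hypergraph) {S S' : Subset (n H)} →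
                PDStep H S S' → PIStep H S S'
pdStep⇒piStep H {S} {S'} (u , u∈S , i , u∈i , forced , S'≡) =
  ⁅ u ⁆ , (u , x∈⁅x⁆ u) , onlyU S u∈S , i , onlyU (edge H i) u∈i ,
  forced′ , S'≡′
  where
  onlyU : (X : Subset (n H)) → u ∈ X → ⁅ u ⁆ ⊆ X
  onlyU X u∈X {x} x∈⁅u⁆ = subst (_∈ X) (sym (x∈⁅y⁆⇒x≡y u x∈⁅u⁆)) u∈X

  forced′ : ∀ v → v ∉ S → (Σ (Fin (m H)) λ j → (⁅ u ⁆ ∪ ⁅ v ⁆) ⊆ edge H j) →
            v ∈ edge H i
  forced′ v v∉S (j , uv⊆j) =
    forced v ((j , uv⊆j (x∈p∪q⁺ (inj₁ (x∈⁅x⁆ u))) , uv⊆j (x∈p∪q⁺ (inj₂ (x∈⁅x⁆ v))))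
             , λ v≡u → v∉S (subst (_∈ S) (sym v≡u) u∈S))
           v∉S

  S'≡′ : ∀ w → (w ∈ S') ⇔ (w ∈ S ⊎ w ∈ edge H i)
  S'≡′ w = mk⇔ toEdge fromEdge
    where
    toEdge : w ∈ S' → w ∈ S ⊎ w ∈ edge H i
    toEdge w∈S' with to (S'≡ w) w∈S' | w ∈? S
    ... | inj₁ w∈S  | _         = inj₁ w∈S
    ... | inj₂ _    | yes w∈S   = inj₁ w∈S
    ... | inj₂ w∈Nu | no w∉S    = inj₂ (forced w w∈Nu w∉S)

    fromEdge : w ∈ S ⊎ w ∈ edge H i → w ∈ S'
    fromEdge (inj₁ w∈S) = from (S'≡ w) (inj₁ w∈S)
    fromEdge (inj₂ w∈i) with w ≟F u
    ... | yes w≡u = from (S'≡ w) (inj₁ (subst (_∈ S) (sym w≡u) u∈S))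
    ... | no w≢u  = from (S'≡ w) (inj₂ ((i , u∈i , w∈i) , w≢u))

γP≤⇒γPI≤ : (H : Hypergraph) (k : ℕ) → γP≤ H k → γPI≤ H k
γP≤⇒γPI≤ H k (S0 , size , S , initial , T , run , T≡⊤) =
  S0 , size , S , initial , T , mapStar (pdStep⇒piStep H) run , T≡⊤

select : ∀ {n} {ℓ} {P : Pred (Fin n) ℓ} → Decidable P → Subset n
select P? = tabulate (λ w → does (P? w))

∈select⇔ : ∀ {n} {ℓ} {P : Pred (Fin n) ℓ} (P? : Decidable P) w →
           (w ∈ select P?) ⇔ P w
∈select⇔ {P = P} P? w = mk⇔ sound complete
  where
  sound : w ∈ select P? → P w
  sound w∈ = invert (subst (Reflects (P w)) doesTrue (proof (P? w)))
    where
    doesTrue : does (P? w) ≡ true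
    doesTrue = trans (sym (lookup∘tabulate _ w)) ([]=⇒lookup w∈)

  complete : P w → w ∈ select P?
  complete Pw = lookup⇒[]= w _ (trans (lookup∘tabulate _ w) (dec-true (P? w) Pw))

∣p∪⁅x⁆∣≤1+∣p∣ : ∀ {n} (p : Subset n) (x : Fin n) → ∣ p ∪ ⁅ x ⁆ ∣ ≤ suc ∣ p ∣
∣p∪⁅x⁆∣≤1+∣p∣ (true  ∷ p) zero    rewrite ∪-identityʳ p = n≤1+n _
∣p∪⁅x⁆∣≤1+∣p∣ (false ∷ p) zero    rewrite ∪-identityʳ p = ≤-refl
∣p∪⁅x⁆∣≤1+∣p∣ (true  ∷ p) (suc x) = s≤s (∣p∪⁅x⁆∣≤1+∣p∣ p x)
∣p∪⁅x⁆∣≤1+∣p∣ (false ∷ p) (suc x) = ∣p∪⁅x⁆∣≤1+∣p∣ p x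

image : ∀ {k n} → (Fin k → Fin n) → Subset k → Subset n
image f []          = ⊥
image f (true  ∷ J) = image (λ j → f (suc j)) J ∪ ⁅ f zero ⁆
image f (false ∷ J) = image (λ j → f (suc j)) J

∈image : ∀ {k n} (f : Fin k → Fin n) {J : Subset k} {j : Fin k} →
         j ∈ J → f j ∈ image f J
∈image f {true ∷ J} here        = x∈p∪q⁺ (inj₂ (x∈⁅x⁆ (f zero)))
∈image f {true ∷ J} (there j∈J) = x∈p∪q⁺ (inj₁ (∈image (λ j → f (suc j)) j∈J))
∈image f {false ∷ J} (there j∈J) = ∈image (λ j → f (suc j)) j∈J

∣image∣≤ : ∀ {k n} (f : Fin k → Fin n) (J : Subset k) → ∣ image f J ∣ ≤ ∣ J ∣
∣image∣≤ {n = n} f [] rewrite ∣⊥∣≡0 n = z≤n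
∣image∣≤ f (true ∷ J) =
  ≤-trans (∣p∪⁅x⁆∣≤1+∣p∣ (image (λ j → f (suc j)) J) (f zero))
          (s≤s (∣image∣≤ (λ j → f (suc j)) J))
∣image∣≤ f (false ∷ J) = ∣image∣≤ (λ j → f (suc j)) J

∣∁⁅i⁆∣ : ∀ {m} (i : Fin m) → ∣ ∁ ⁅ i ⁆ ∣ ≡ m ∸ 1
∣∁⁅i⁆∣ {m} i = trans (∣∁p∣≡n∸∣p∣ ⁅ i ⁆) (cong (m ∸_) (∣⁅x⁆∣≡1 i))

module _ (H : Hypergraph) where

  adj? : ∀ u w → Dec (Adj H u w)
  adj? u w = any? (λ i → (u ∈? edge H i) ×-dec (w ∈? edge H i))

  inClosedNbhdOf? : ∀ S0 w → Dec (Σ (V H) λ v → v ∈ S0 × InClosedNbhd H v w)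
  inClosedNbhdOf? S0 w = any? (λ v → (v ∈? S0) ×-dec adj? v w)

  closedNbhdOf : Subset (n H) → Subset (n H)
  closedNbhdOf S0 = select (inClosedNbhdOf? S0)

  initial-closedNbhdOf : ∀ S0 → Initial H S0 (closedNbhdOf S0)
  initial-closedNbhdOf S0 = ∈select⇔ (inClosedNbhdOf? S0)

  -- In a connected hypergraph with an edge, every vertex lies in an edge:
  -- the first step of a walk to a vertex of that edge provides one.
  inSomeEdge : Connected H → Fin (m H) → ∀ w → Σ (Fin (m H)) λ j → w ∈ edge H j
  inSomeEdge conn i w with conn w (proj₁ (nonempty H i))
  ... | ε                   = i , proj₂ (nonempty H i)
  ... | (j , w∈j , _) ◅ _ = j , w∈j

  MeetsOtherEdge : Fin (m H) → V H → Set
  MeetsOtherEdge i u = u ∈ edge H i × Σ (Fin (m H)) λ j → j ≢ i × u ∈ edge H j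

  walkStaysInEdge : ∀ i → (∀ u → ¬ MeetsOtherEdge i u) →
                    ∀ {z y} → z ∈ edge H i → Star (Adj H) z y → y ∈ edge H i
  walkStaysInEdge i isolated z∈i ε = z∈i
  walkStaysInEdge i isolated {z} z∈i ((j , z∈j , z'∈j) ◅ walk) with j ≟F i
  ... | yes refl = walkStaysInEdge i isolated z'∈j walk
  ... | no j≢i   = ⊥-elim (isolated z (z∈i , j , j≢i , z∈j))

  -- If H is connected and has an edge j ≠ i, some vertex of edge i lies in
  -- another edge: otherwise edge j ⊆ edge i, contradicting reducedness.
  edgeMeetsAnother : Connected H → ∀ i j → j ≢ i → Σ (V H) (MeetsOtherEdge i)
  edgeMeetsAnother conn i j j≢i
    with any? (λ u → (u ∈? edge H i) ×-dec any? (λ j′ → ¬? (j′ ≟F i) ×-dec (u ∈? edge H j′)))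
  ... | yes (u , u∈i , j′ , j′≢i , u∈j′) = u , u∈i , j′ , j′≢i , u∈j′
  ... | no none = ⊥-elim (j≢i (reduced H j i j⊆i))
    where
    j⊆i : edge H j ⊆ edge H i
    j⊆i {y} _ = walkStaysInEdge i (λ u met → none (u , met))
                  (proj₂ (nonempty H i)) (conn (proj₁ (nonempty H i)) y)

  lastEdgeStep : ∀ (S : Subset (n H)) i u →
                 (∀ j → j ≢ i → edge H j ⊆ S) → u ∈ S → u ∈ edge H i →
                 (∀ w → Σ (Fin (m H)) λ j → w ∈ edge H j) → PDStep H S ⊤
  lastEdgeStep S i u others⊆S u∈S u∈i covered =
    u , u∈S , i , u∈i , forced , λ w → mk⇔ (λ _ → observed w) (λ _ → ∈⊤)
    where
    forced : ∀ w → InOpenNbhd H u w → w ∉ S → w ∈ edge H i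
    forced w ((j , _ , w∈j) , _) w∉S with j ≟F i
    ... | yes refl = w∈j
    ... | no j≢i   = ⊥-elim (w∉S (others⊆S j j≢i w∈j))

    observed : ∀ w → w ∈ S ⊎ InOpenNbhd H u w
    observed w with covered w
    ... | j , w∈j with j ≟F i | w ≟F u
    ...   | no j≢i   | _       = inj₁ (others⊆S j j≢i w∈j)
    ...   | yes refl | yes refl = inj₁ u∈S
    ...   | yes refl | no w≢u  = inj₂ ((i , u∈i , w∈j) , w≢u)

  -- A run of infectious steps ending with every vertex observed starts from
  -- a set that is nonempty whenever H has a vertex: either the run is empty,
  -- or its first step uses a nonempty set A of observed vertices.
  completedRunStartsNonempty : V H → ∀ {S T} → Star (PIStep H) S T → T ≡ ⊤ →
                               Σ (V H) (_∈ S)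
  completedRunStartsNonempty x ε T≡⊤ = x , subst (x ∈_) (sym T≡⊤) ∈⊤
  completedRunStartsNonempty x ((_ , (a , a∈A) , A⊆S , _) ◅ _) _ = a , A⊆S a∈A

  -- Any nonempty hypergraph needs a nonempty infectious power dominating
  -- set, since N[v] for v ∈ S0 is all that is observed initially.
  γPI≥1 : V H → ∀ k → γPI≤ H k → 1 ≤ k
  γPI≥1 x k (S0 , size , S , initial , T , run , T≡⊤)
    with completedRunStartsNonempty x run T≡⊤
  ... | w , w∈S with to (initial w) w∈S
  ...   | v , v∈S0 , _ =
    ≤-trans (≤-reflexive (sym (∣⁅x⁆∣≡1 v)))
            (≤-trans (p⊆q⇒∣p∣≤∣q∣ {p = ⁅ v ⁆} {q = S0} ⁅v⁆⊆S0) size)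
    where
    ⁅v⁆⊆S0 : ⁅ v ⁆ ⊆ S0
    ⁅v⁆⊆S0 y∈ = subst (_∈ S0) (sym (x∈⁅y⁆⇒x≡y v y∈)) v∈S0

twoEdges : ∀ {m} → 2 ≤ m → Σ (Fin m) λ i → Σ (Fin m) λ j → j ≢ i
twoEdges 2≤m = fromℕ< 0<m , fromℕ< 2≤m , λ eq →
  0≢1 (trans (sym (toℕ-fromℕ< 0<m)) (trans (cong toℕ (sym eq)) (toℕ-fromℕ< 2≤m)))
  where
  0<m : 0 < _
  0<m = ≤-trans (s≤s z≤n) 2≤m
  0≢1 : 0 ≢ 1
  0≢1 ()

-- Observing one vertex per edge other than i₀ leaves only edge i₀ to be
-- observed, which a vertex of i₀ in another edge does in a single step.
γP≤|E|-1 : (H : Hypergraph) → Connected H → 2 ≤ numEdges H → γP≤ H (numEdges H ∸ 1)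
γP≤|E|-1 H conn 2≤m = S0 , size , S , initial-closedNbhdOf H S0 , ⊤ , step ◅ ε , refl
  where
  i₀ : Fin (m H)
  i₀ = proj₁ (twoEdges 2≤m)

  pick : Fin (m H) → V H
  pick j = proj₁ (nonempty H j)

  S0 : Subset (n H)
  S0 = image pick (∁ ⁅ i₀ ⁆)

  size : ∣ S0 ∣ ≤ numEdges H ∸ 1
  size = subst (∣ S0 ∣ ≤_) (∣∁⁅i⁆∣ i₀) (∣image∣≤ pick (∁ ⁅ i₀ ⁆))

  S : Subset (n H)
  S = closedNbhdOf H S0

  others⊆S : ∀ j → j ≢ i₀ → edge H j ⊆ S
  others⊆S j j≢i₀ {w} w∈j = from (initial-closedNbhdOf H S0 w)
    (pick j , ∈image pick (x∉p⇒x∈∁p (λ j∈ → j≢i₀ (x∈⁅y⁆⇒x≡y i₀ j∈))) ,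
     j , proj₂ (nonempty H j) , w∈j)

  meeting : Σ (V H) (MeetsOtherEdge H i₀)
  meeting = edgeMeetsAnother H conn i₀ _ (proj₂ (proj₂ (twoEdges 2≤m)))

  step : PDStep H S ⊤
  step with meeting
  ... | u , u∈i₀ , j , j≢i₀ , u∈j =
    lastEdgeStep H S i₀ u others⊆S (others⊆S j j≢i₀ u∈j) u∈i₀ (inSomeEdge H conn i₀)

pathEdge : Fin 2 → Subset 3
pathEdge zero       = true  ∷ true ∷ false ∷ []
pathEdge (suc zero) = false ∷ true ∷ true  ∷ []

pathReduced : ∀ i j → pathEdge i ⊆ pathEdge j → i ≡ j
pathReduced zero       zero       _ = refl
pathReduced (suc zero) (suc zero) _ = refl
pathReduced zero       (suc zero) 01⊆12 with 01⊆12 here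
... | ()
pathReduced (suc zero) zero       12⊆01 with 12⊆01 (there (there here))
... | there (there ())

path : Hypergraph
path = record
  { n = 3 ; m = 2 ; edge = pathEdge
  ; nonempty = λ i → suc zero , middle i
  ; reduced = pathReduced }
  where
  middle : ∀ i → suc zero ∈ pathEdge i
  middle zero       = there here
  middle (suc zero) = there here

-- Every vertex shares an edge with the middle vertex b.
pathConnected : Connected path
pathConnected u w = toMiddle u ◅◅ fromMiddle w
  where
  b : V path
  b = suc zero

  adjMiddle : ∀ u → Adj path u b × Adj path b u
  adjMiddle zero             = (zero , here , there here) , (zero , there here , here)
  adjMiddle (suc zero)       = (zero , there here , there here) , (zero , there here , there here)
  adjMiddle (suc (suc zero)) = (suc zero , there (there here) , there here)
                             , (suc zero , there here , there (there here))

  toMiddle : ∀ u → Star (Adj path) u b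
  toMiddle u = proj₁ (adjMiddle u) ◅ ε

  fromMiddle : ∀ u → Star (Adj path) b u
  fromMiddle u = proj₂ (adjMiddle u) ◅ ε

-- The two general bounds, and the path attaining both (the value is 1 by
-- the upper bound and γPI≥1, transferred to γ_P by γP≤⇒γPI≤).
proposition4p2 : ((H : Hypergraph) → Connected H → 2 ≤ numEdges H →
    ((k : ℕ) → γP≤ H k → γPI≤ H k) × γP≤ H (numEdges H ∸ 1))
    ×
    (Σ Hypergraph λ H → Connected H × 2 ≤ numEdges H ×
    γPI≡ H (numEdges H ∸ 1) × γP≡ H (numEdges H ∸ 1))
proposition4p2 =
  (λ H conn 2≤m → γP≤⇒γPI≤ H , γP≤|E|-1 H conn 2≤m) ,
  (path , pathConnected , 2≤2 ,
    (γP≤⇒γPI≤ path 1 upper , γPI≥1 path zero) ,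
    (upper , λ k γP≤k → γPI≥1 path zero k (γP≤⇒γPI≤ path k γP≤k)))
  where
  2≤2 : 2 ≤ numEdges path
  2≤2 = s≤s (s≤s z≤n)

  upper : γP≤ path 1
  upper = γP≤|E|-1 path pathConnected 2≤2
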